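{- Let $m\ge3$ and $n\ge1$ be integers. The cylindrical graph $C_m\square P_n$ admits an efficient dominating set if and only if either $n=1$ and $m\equiv0\pmod 3$, or $n=2$ and $m\equiv 0\pmod 4$.
   Context: $C_m$ is the cycle on $m$ vertices, $P_n$ the path on $n$ vertices, and $\square$ the Cartesian product. A set $D\subseteq V(G)$ is an efficient dominating set of $G$ if every vertex of $G$ belongs to the closed neighborhood $N[u]=N(u)\cup\{u\}$ of exactly one vertex $u\in D$. -}

module Defs where

open import Data.Nat using (ℕ; suc; _+_; _%_; NonZero)
open import Data.Fin using (Fin; toℕ)
open import Data.Product using (_×_; _,_; ∃; Σ-syntax)
open import Data.Sum using (_⊎_)
open import Data.Bool using (Bool; true)
open import Relation.Binary.PropositionalEquality using (_≡_)

record Graph (V : Set) : Set₁ where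
  field
    Adj : V → V → Set

open Graph public

SuccMod : (m : ℕ) → Fin m → Fin m → Set
SuccMod m i j = (toℕ j ≡ suc (toℕ i)) ⊎ (suc (toℕ i) ≡ m × toℕ j ≡ 0)

Cycle : (m : ℕ) → Graph (Fin m)
Adj (Cycle m) i j = SuccMod m i j ⊎ SuccMod m j i

Path : (n : ℕ) → Graph (Fin n)
Adj (Path n) i j = (toℕ j ≡ suc (toℕ i)) ⊎ (toℕ i ≡ suc (toℕ j))

_□_ : {V W : Set} → Graph V → Graph W → Graph (V × W)
Adj (G □ H) (g , h) (g' , h') = (Adj G g g' × h ≡ h') ⊎ (g ≡ g' × Adj H h h')

InClosedNbhd : {V : Set} → Graph V → V → V → Set
InClosedNbhd G v u = (v ≡ u) ⊎ Adj G u v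

IsEfficientDominatingSet : {V : Set} → Graph V → (V → Bool) → Set
IsEfficientDominatingSet {V} G D =
  (v : V) → ∃ λ u → (D u ≡ true × InClosedNbhd G v u)
                   × ((w : V) → D w ≡ true → InClosedNbhd G v w → w ≡ u)

HasEfficientDominatingSet : {V : Set} → Graph V → Set
HasEfficientDominatingSet {V} G = Σ[ D ∈ (V → Bool) ] IsEfficientDominatingSet G D

-- Let D be an efficient dominating set of C_m □ P_n and look at the bottom row.
-- With one row, a dominator at i forces the next dominator at i + 3 and excludes
-- i + 1 and i + 2.  With two or more rows, a dominator (i , 0) forces (i + 2 , 1),
-- which in turn forces (i + 4 , 0), while (i + 1 , 0), (i + 2 , 0), (i + 3 , 0) are
-- excluded.  Going once around the cycle, the dominators of the bottom row are thus
-- exactly 3, resp. 4, apart, so 3 ∣ m, resp. 4 ∣ m.  With a third row there is no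
-- room at all: once (i , 1), (i + 2 , 0) and (i + 4 , 1) dominate, the vertex
-- (i + 2 , 2) has no admissible dominator.
-- Conversely, reducing the cycle coordinate modulo a divisor K ≥ 3 of m is a covering
-- C_m □ P_n → C_K □ P_n, efficient dominating sets pull back along coverings, and
-- {(i , r) | i = 2r} is efficient in C_3 □ P_1 and in C_4 □ P_2.
module Submission where

open import Defs
open import Data.Bool using (Bool; true)
import Data.Bool.Properties as Bool
open import Data.Empty using (⊥; ⊥-elim)
open import Data.Fin using (Fin; toℕ; zero; suc; fromℕ<)
import Data.Fin.Properties as Fin
open import Data.Fin.Properties using (toℕ-injective; toℕ<n; toℕ-fromℕ<)
open import Data.Nat using (ℕ; zero; suc; pred; _+_; _*_; _/_; _%_; _≤_; _<_; s≤s; z≤n; NonZero; _≟_; _≡ᵇ_)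
open import Data.Nat.DivMod
  using ( _mod_; m<n⇒m%n≡m; n%n≡0; m%n%n≡m%n; [m+n]%n≡m%n; %-distribˡ-+; m≡m%n+[m/n]*n; m%n<n
        ; m∣n⇒o%n%m≡o%m)
open import Data.Nat.Divisibility using (_∣_; divides; ∣1⇒≡1; ∣⇒≤; m%n≡0⇒n∣m)
open import Data.Nat.Properties
  using (≤-refl; <⇒≤; 1+n≢n; +-identityʳ; +-suc; +-comm; +-cancelˡ-≡; suc-pred; m≤n⇒m<n∨m≡n)
open import Data.Product using (_×_; _,_; ∃; proj₂; map₁)
open import Data.Product.Properties using (≡-dec; ,-injectiveˡ; ,-injectiveʳ)
open import Data.Sum using (_⊎_; inj₁; inj₂)
import Data.Sum as Sum
open import Function using (_∘_)
open import Function.Bundles using (_⇔_; mk⇔)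
open import Relation.Binary.PropositionalEquality
import Relation.Binary.Definitions as B
open import Relation.Nullary using (¬_; Dec; contradiction; map′; _×-dec_; _⊎-dec_; _→-dec_)
open import Relation.Nullary.Decidable using (toWitness)
open import Relation.Unary using (Decidable)

module _ {m : ℕ} .{{_ : NonZero m}} where

  next : Fin m → Fin m
  next i = suc (toℕ i) mod m

  next^ : ℕ → Fin m → Fin m
  next^ zero    i = i
  next^ (suc t) i = next (next^ t i)

  prev : Fin m → Fin m
  prev = next^ (pred m)

  toℕ-next : ∀ i → toℕ (next i) ≡ suc (toℕ i) % m
  toℕ-next i = toℕ-fromℕ< _

  [1+a%m]%m≡[1+a]%m : ∀ a → suc (a % m) % m ≡ suc a % m
  [1+a%m]%m≡[1+a]%m a = begin
    suc (a % m) % m           ≡⟨ %-distribˡ-+ 1 (a % m) m ⟩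
    (1 % m + a % m % m) % m   ≡⟨ cong (λ x → (1 % m + x) % m) (m%n%n≡m%n a m) ⟩
    (1 % m + a % m) % m       ≡⟨ %-distribˡ-+ 1 a m ⟨
    suc a % m                 ∎
    where open ≡-Reasoning

  toℕ-next^ : ∀ t i → toℕ (next^ t i) ≡ (toℕ i + t) % m
  toℕ-next^ zero i = begin
    toℕ i             ≡⟨ m<n⇒m%n≡m (toℕ<n i) ⟨
    toℕ i % m         ≡⟨ cong (_% m) (+-identityʳ (toℕ i)) ⟨
    (toℕ i + 0) % m   ∎
    where open ≡-Reasoning
  toℕ-next^ (suc t) i = begin
    toℕ (next (next^ t i))     ≡⟨ toℕ-next (next^ t i) ⟩
    suc (toℕ (next^ t i)) % m  ≡⟨ cong (λ x → suc x % m) (toℕ-next^ t i) ⟩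
    suc ((toℕ i + t) % m) % m  ≡⟨ [1+a%m]%m≡[1+a]%m (toℕ i + t) ⟩
    suc (toℕ i + t) % m        ≡⟨ cong (_% m) (+-suc (toℕ i) t) ⟨
    (toℕ i + suc t) % m        ∎
    where open ≡-Reasoning

  next^-+ : ∀ a b i → next^ (a + b) i ≡ next^ a (next^ b i)
  next^-+ zero    b i = refl
  next^-+ (suc a) b i = cong next (next^-+ a b i)

  next^-period : ∀ i → next^ m i ≡ i
  next^-period i = toℕ-injective (begin
    toℕ (next^ m i)  ≡⟨ toℕ-next^ m i ⟩
    (toℕ i + m) % m  ≡⟨ [m+n]%n≡m%n (toℕ i) m ⟩
    toℕ i % m        ≡⟨ m<n⇒m%n≡m (toℕ<n i) ⟩
    toℕ i            ∎)
    where open ≡-Reasoning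

  next^-fixed⇒m∣t : ∀ t i → next^ t i ≡ i → m ∣ t
  next^-fixed⇒m∣t t i eq = divides q (+-cancelˡ-≡ (toℕ i) t (q * m) (begin
    toℕ i + t                 ≡⟨ m≡m%n+[m/n]*n (toℕ i + t) m ⟩
    (toℕ i + t) % m + q * m   ≡⟨ cong (_+ q * m) remainder ⟩
    toℕ i + q * m             ∎))
    where
    open ≡-Reasoning

    q : ℕ
    q = (toℕ i + t) / m

    remainder : (toℕ i + t) % m ≡ toℕ i
    remainder = trans (sym (toℕ-next^ t i)) (cong toℕ eq)

  next-prev : ∀ i → next (prev i) ≡ i
  next-prev i = trans (cong (λ t → next^ t i) (suc-pred m)) (next^-period i)

  prev-next : ∀ i → prev (next i) ≡ i
  prev-next i = begin
    next^ (pred m) (next^ 1 i)  ≡⟨ next^-+ (pred m) 1 i ⟨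
    next^ (pred m + 1) i        ≡⟨ cong (λ t → next^ t i) (trans (+-comm (pred m) 1) (suc-pred m)) ⟩
    next^ m i                   ≡⟨ next^-period i ⟩
    i                           ∎
    where open ≡-Reasoning

  next-injective : ∀ {i j} → next i ≡ next j → i ≡ j
  next-injective {i} {j} eq = trans (sym (prev-next i)) (trans (cong prev eq) (prev-next j))

  next≢id : 2 ≤ m → ∀ i → next i ≢ i
  next≢id 2≤m i eq with ∣1⇒≡1 (next^-fixed⇒m∣t 1 i eq) | 2≤m
  ... | refl | s≤s ()

  next²≢id : 3 ≤ m → ∀ i → next (next i) ≢ i
  next²≢id 3≤m i eq with ∣⇒≤ (next^-fixed⇒m∣t 2 i eq) | 3≤m
  ... | s≤s (s≤s ()) | s≤s (s≤s (s≤s _))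

  periodic⇒m%P≡0 : (Q : Fin m → Set) (P : ℕ) .{{_ : NonZero P}} →
                   (∀ {i} → Q i → Q (next^ P i)) →
                   (∀ {i} t → t < P → Q i → Q (next^ t i) → t ≡ 0) →
                   ∃ Q → m % P ≡ 0
  periodic⇒m%P≡0 Q P step gap (i₀ , Qi₀) =
    gap (m % P) (m%n<n m P) (Q-multiple (m / P)) (subst Q i₀-via-i Qi₀)
    where
    Q-multiple : ∀ q → Q (next^ (q * P) i₀)
    Q-multiple zero    = Qi₀
    Q-multiple (suc q) = subst Q (sym (next^-+ P (q * P) i₀)) (step (Q-multiple q))

    i₀-via-i : i₀ ≡ next^ (m % P) (next^ (m / P * P) i₀)
    i₀-via-i = begin
      i₀                                     ≡⟨ next^-period i₀ ⟨
      next^ m i₀                             ≡⟨ cong (λ t → next^ t i₀) (m≡m%n+[m/n]*n m P) ⟩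
      next^ (m % P + m / P * P) i₀           ≡⟨ next^-+ (m % P) (m / P * P) i₀ ⟩
      next^ (m % P) (next^ (m / P * P) i₀)   ∎
      where open ≡-Reasoning

  succMod-next : ∀ i → SuccMod m i (next i)
  succMod-next i with m≤n⇒m<n∨m≡n (toℕ<n i)
  ... | inj₁ 1+i<m = inj₁ (trans (toℕ-next i) (m<n⇒m%n≡m 1+i<m))
  ... | inj₂ 1+i≡m = inj₂ (1+i≡m , trans (toℕ-next i) (trans (cong (_% m) 1+i≡m) (n%n≡0 m)))

  succMod⇒next : ∀ {i j} → SuccMod m i j → j ≡ next i
  succMod⇒next {i} {j} (inj₁ j≡1+i) = toℕ-injective (begin
    toℕ j              ≡⟨ m<n⇒m%n≡m (toℕ<n j) ⟨
    toℕ j % m          ≡⟨ cong (_% m) j≡1+i ⟩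
    suc (toℕ i) % m    ≡⟨ toℕ-next i ⟨
    toℕ (next i)       ∎)
    where open ≡-Reasoning
  succMod⇒next {i} {j} (inj₂ (1+i≡m , j≡0)) = toℕ-injective (begin
    toℕ j              ≡⟨ j≡0 ⟩
    0                  ≡⟨ n%n≡0 m ⟨
    m % m              ≡⟨ cong (_% m) 1+i≡m ⟨
    suc (toℕ i) % m    ≡⟨ toℕ-next i ⟨
    toℕ (next i)       ∎)
    where open ≡-Reasoning

  cycle-adj⇒ : ∀ {i j} → Adj (Cycle m) i j → j ≡ next i ⊎ i ≡ next j
  cycle-adj⇒ = Sum.map succMod⇒next succMod⇒next

  cycle-adj⇐ : ∀ {i j} → j ≡ next i ⊎ i ≡ next j → Adj (Cycle m) i j
  cycle-adj⇐ (inj₁ refl) = inj₁ (succMod-next _)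
  cycle-adj⇐ (inj₂ refl) = inj₂ (succMod-next _)

Loopless : {V : Set} → Graph V → Set
Loopless {V} G = ∀ {v : V} → ¬ Adj G v v

cycle-loopless : ∀ {m} .{{_ : NonZero m}} → 2 ≤ m → Loopless (Cycle m)
cycle-loopless 2≤m a with cycle-adj⇒ a
... | inj₁ e = next≢id 2≤m _ (sym e)
... | inj₂ e = next≢id 2≤m _ (sym e)

path-loopless : ∀ {n} → Loopless (Path n)
path-loopless (inj₁ e) = 1+n≢n (sym e)
path-loopless (inj₂ e) = 1+n≢n (sym e)

□-loopless : ∀ {V W} {G : Graph V} {H : Graph W} → Loopless G → Loopless H → Loopless (G □ H)
□-loopless G-loopless H-loopless (inj₁ (a , _)) = G-loopless a
□-loopless G-loopless H-loopless (inj₂ (_ , a)) = H-loopless a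

record IsCovering {V W : Set} (G : Graph V) (H : Graph W) (φ : V → W) : Set where
  field
    adj-preserved : ∀ {u v} → Adj G u v → Adj H (φ u) (φ v)
    adj-lifted    : ∀ {u′ v} → Adj H u′ (φ v) → ∃ λ u → Adj G u v × φ u ≡ u′
    adj-injective : ∀ {u w v} → Adj G u v → Adj G w v → φ u ≡ φ w → u ≡ w

module _ {V W : Set} {G : Graph V} {H : Graph W} {φ : V → W} (cov : IsCovering G H φ) where
  open IsCovering cov

  ∈N-preserved : ∀ {v u} → InClosedNbhd G v u → InClosedNbhd H (φ v) (φ u)
  ∈N-preserved (inj₁ refl) = inj₁ refl
  ∈N-preserved (inj₂ a)    = inj₂ (adj-preserved a)

  ∈N-lifted : ∀ {v u′} → InClosedNbhd H (φ v) u′ → ∃ λ u → InClosedNbhd G v u × φ u ≡ u′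
  ∈N-lifted (inj₁ refl) = _ , inj₁ refl , refl
  ∈N-lifted (inj₂ a) with adj-lifted a
  ... | u , a′ , φu≡u′ = u , inj₂ a′ , φu≡u′

  ∈N-injective : Loopless H → ∀ {v u w} → InClosedNbhd G v u → InClosedNbhd G v w → φ u ≡ φ w → u ≡ w
  ∈N-injective H-loopless (inj₁ refl) (inj₁ refl) _ = refl
  ∈N-injective H-loopless (inj₁ refl) (inj₂ a)    e =
    ⊥-elim (H-loopless (subst (λ x → Adj H x (φ _)) (sym e) (adj-preserved a)))
  ∈N-injective H-loopless (inj₂ a)    (inj₁ refl) e =
    ⊥-elim (H-loopless (subst (λ x → Adj H x (φ _)) e (adj-preserved a)))
  ∈N-injective H-loopless (inj₂ a)    (inj₂ b)    e = adj-injective a b e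

  efficient-pullback : Loopless H → ∀ {D} → IsEfficientDominatingSet H D → IsEfficientDominatingSet G (D ∘ φ)
  efficient-pullback H-loopless eds v with eds (φ v)
  ... | _ , (Du′ , φv∈N[u′]) , unique with ∈N-lifted φv∈N[u′]
  ...   | u , v∈N[u] , refl =
    u , (Du′ , v∈N[u]) ,
    λ w Dφw v∈N[w] → ∈N-injective H-loopless v∈N[w] v∈N[u] (unique (φ w) Dφw (∈N-preserved v∈N[w]))

□-covering : ∀ {V W U} {G : Graph V} {H : Graph W} {P : Graph U} {φ : V → W} →
             IsCovering G H φ → Loopless P → IsCovering (G □ P) (H □ P) (map₁ φ)
□-covering {G = G} {H} {P} {φ} cov P-loopless = record
  { adj-preserved = preserved
  ; adj-lifted    = lifted
  ; adj-injective = injective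
  }
  where
  open IsCovering cov

  preserved : ∀ {u v} → Adj (G □ P) u v → Adj (H □ P) (map₁ φ u) (map₁ φ v)
  preserved (inj₁ (a , e)) = inj₁ (adj-preserved a , e)
  preserved (inj₂ (e , a)) = inj₂ (cong φ e , a)

  lifted : ∀ {u′ v} → Adj (H □ P) u′ (map₁ φ v) → ∃ λ u → Adj (G □ P) u v × map₁ φ u ≡ u′
  lifted {_ , x} (inj₁ (a , e)) with adj-lifted a
  ... | u , a′ , refl = (u , x) , inj₁ (a′ , e) , refl
  lifted {_ , x} {g , _} (inj₂ (refl , a)) = (g , x) , inj₂ (refl , a) , refl

  injective : ∀ {u w v} → Adj (G □ P) u v → Adj (G □ P) w v → map₁ φ u ≡ map₁ φ w → u ≡ w
  injective (inj₁ (a , refl)) (inj₁ (b , refl)) e = cong (_, _) (adj-injective a b (,-injectiveˡ e))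
  injective (inj₂ (refl , a)) (inj₂ (refl , b)) e = cong (_ ,_) (,-injectiveʳ e)
  injective (inj₁ (a , refl)) (inj₂ (refl , b)) e =
    ⊥-elim (P-loopless (subst (λ x → Adj P x _) (sym (,-injectiveʳ e)) b))
  injective (inj₂ (refl , a)) (inj₁ (b , refl)) e =
    ⊥-elim (P-loopless (subst (λ x → Adj P x _) (,-injectiveʳ e) a))

module _ {m K : ℕ} .{{_ : NonZero m}} .{{_ : NonZero K}} where

  reduce : Fin m → Fin K
  reduce i = toℕ i mod K

  toℕ-reduce : ∀ i → toℕ (reduce i) ≡ toℕ i % K
  toℕ-reduce i = toℕ-fromℕ< _

  reduce-next : K ∣ m → ∀ i → reduce (next i) ≡ next (reduce i)
  reduce-next K∣m i = toℕ-injective (begin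
    toℕ (reduce (next i))      ≡⟨ toℕ-reduce (next i) ⟩
    toℕ (next i) % K           ≡⟨ cong (_% K) (toℕ-next i) ⟩
    suc (toℕ i) % m % K        ≡⟨ m∣n⇒o%n%m≡o%m K m (suc (toℕ i)) K∣m ⟩
    suc (toℕ i) % K            ≡⟨ [1+a%m]%m≡[1+a]%m (toℕ i) ⟨
    suc (toℕ i % K) % K        ≡⟨ cong (λ x → suc x % K) (toℕ-reduce i) ⟨
    suc (toℕ (reduce i)) % K   ≡⟨ toℕ-next (reduce i) ⟨
    toℕ (next (reduce i))      ∎)
    where open ≡-Reasoning

  cycle-covering : K ∣ m → 3 ≤ K → IsCovering (Cycle m) (Cycle K) reduce
  cycle-covering K∣m 3≤K = record
    { adj-preserved = λ a → cycle-adj⇐ (Sum.map reduce-≡next reduce-≡next (cycle-adj⇒ a))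
    ; adj-lifted    = lifted
    ; adj-injective = injective
    }
    where
    reduce-≡next : ∀ {i j : Fin m} → j ≡ next i → reduce j ≡ next (reduce i)
    reduce-≡next refl = reduce-next K∣m _

    reduce-next² : ∀ i → reduce (next (next i)) ≡ next (next (reduce i))
    reduce-next² i = trans (reduce-next K∣m (next i)) (cong next (reduce-next K∣m i))

    lifted : ∀ {u′ v} → Adj (Cycle K) u′ (reduce v) → ∃ λ u → Adj (Cycle m) u v × reduce u ≡ u′
    lifted {v = v} a with cycle-adj⇒ a
    ... | inj₁ e    = prev v , cycle-adj⇐ (inj₁ (sym (next-prev v))) ,
                      next-injective (trans (sym (reduce-≡next (sym (next-prev v)))) e)
    ... | inj₂ refl = next v , cycle-adj⇐ (inj₂ refl) , reduce-next K∣m v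

    injective : ∀ {u w v} → Adj (Cycle m) u v → Adj (Cycle m) w v → reduce u ≡ reduce w → u ≡ w
    injective a b e with cycle-adj⇒ a | cycle-adj⇒ b
    ... | inj₁ v≡next-u | inj₁ v≡next-w = next-injective (trans (sym v≡next-u) v≡next-w)
    ... | inj₂ refl     | inj₂ refl     = refl
    ... | inj₁ refl     | inj₂ refl     = ⊥-elim (next²≢id 3≤K _ (sym (trans e (reduce-next² _))))
    ... | inj₂ refl     | inj₁ refl     = ⊥-elim (next²≢id 3≤K _ (trans (sym (reduce-next² _)) e))

efficient-from-divisor : ∀ {m K n} .{{_ : NonZero m}} .{{_ : NonZero K}} {D : Fin K × Fin n → Bool} →
                         K ∣ m → 3 ≤ K → IsEfficientDominatingSet (Cycle K □ Path n) D →
                         HasEfficientDominatingSet (Cycle m □ Path n)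
efficient-from-divisor {K = K} {n} K∣m 3≤K eds =
  _ , efficient-pullback (□-covering (cycle-covering K∣m 3≤K) path-loopless)
                         (□-loopless {G = Cycle K} {H = Path n} (cycle-loopless (<⇒≤ 3≤K)) path-loopless) eds

cycle-adj? : ∀ {m} → B.Decidable (Adj (Cycle m))
cycle-adj? {m} i j = succMod? i j ⊎-dec succMod? j i
  where
  succMod? : B.Decidable (SuccMod m)
  succMod? i j = (toℕ j ≟ suc (toℕ i)) ⊎-dec ((suc (toℕ i) ≟ m) ×-dec (toℕ j ≟ 0))

path-adj? : ∀ {n} → B.Decidable (Adj (Path n))
path-adj? i j = (toℕ j ≟ suc (toℕ i)) ⊎-dec (toℕ i ≟ suc (toℕ j))

module _ {a b : ℕ} where

  private
    V = Fin a × Fin b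

    _≟ᵥ_ : B.DecidableEquality V
    _≟ᵥ_ = ≡-dec Fin._≟_ Fin._≟_

  all×? : {P : V → Set} → Decidable P → Dec (∀ v → P v)
  all×? P? = map′ (λ ∀P (i , j) → ∀P i j) (λ ∀P i j → ∀P (i , j))
                  (Fin.all? λ i → Fin.all? λ j → P? (i , j))

  any×? : {P : V → Set} → Decidable P → Dec (∃ P)
  any×? P? = map′ (λ (i , j , p) → (i , j) , p) (λ ((i , j) , p) → i , j , p)
                  (Fin.any? λ i → Fin.any? λ j → P? (i , j))

  □-adj? : {G : Graph (Fin a)} {H : Graph (Fin b)} → B.Decidable (Adj G) → B.Decidable (Adj H) →
           B.Decidable (Adj (G □ H))
  □-adj? G? H? (g , h) (g′ , h′) = (G? g g′ ×-dec h Fin.≟ h′) ⊎-dec (g Fin.≟ g′ ×-dec H? h h′)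

  efficient? : {G : Graph V} → B.Decidable (Adj G) → (D : V → Bool) → Dec (IsEfficientDominatingSet G D)
  efficient? {G} adj? D = all×? λ v → any×? λ u →
    ((D u Bool.≟ true) ×-dec ∈N? v u) ×-dec
    all×? λ w → (D w Bool.≟ true) →-dec (∈N? v w →-dec (w ≟ᵥ u))
    where
    ∈N? : B.Decidable (InClosedNbhd G)
    ∈N? v u = (v ≟ᵥ u) ⊎-dec adj? u v

seed : ∀ {m n} → Fin m × Fin n → Bool
seed (i , r) = toℕ i ≡ᵇ 2 * toℕ r

seed-C₃□P₁ : IsEfficientDominatingSet (Cycle 3 □ Path 1) seed
seed-C₃□P₁ = toWitness {a? = efficient? (□-adj? cycle-adj? path-adj?) seed} _

seed-C₄□P₂ : IsEfficientDominatingSet (Cycle 4 □ Path 2) seed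
seed-C₄□P₂ = toWitness {a? = efficient? (□-adj? cycle-adj? path-adj?) seed} _

module Domination {m n : ℕ} .{{_ : NonZero m}} (3≤m : 3 ≤ m) {D : Fin m × Fin n → Bool}
                  (eds : IsEfficientDominatingSet (Cycle m □ Path n) D) where

  Vertex : Set
  Vertex = Fin m × Fin n

  _∈N[_] : Vertex → Vertex → Set
  v ∈N[ u ] = InClosedNbhd (Cycle m □ Path n) v u

  ∈N-self : ∀ {v} → v ∈N[ v ]
  ∈N-self = inj₁ refl

  ∈N-next : ∀ {i r} → (next i , r) ∈N[ (i , r) ]
  ∈N-next = inj₂ (inj₁ (cycle-adj⇐ (inj₁ refl) , refl))

  ∈N-prev : ∀ {i r} → (i , r) ∈N[ (next i , r) ]
  ∈N-prev = inj₂ (inj₁ (cycle-adj⇐ (inj₂ refl) , refl))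

  ∈N-up : ∀ {i r q} → toℕ q ≡ suc (toℕ r) → (i , q) ∈N[ (i , r) ]
  ∈N-up e = inj₂ (inj₂ (refl , inj₁ e))

  ∈N-down : ∀ {i r q} → toℕ q ≡ suc (toℕ r) → (i , r) ∈N[ (i , q) ]
  ∈N-down e = inj₂ (inj₂ (refl , inj₂ e))

  data ClosedNbhdView (i : Fin m) (r : Fin n) : Vertex → Set where
    here  : ClosedNbhdView i r (i , r)
    right : ClosedNbhdView i r (next i , r)
    left  : ∀ {j} → next j ≡ i → ClosedNbhdView i r (j , r)
    above : ∀ {q} → toℕ q ≡ suc (toℕ r) → ClosedNbhdView i r (i , q)
    below : ∀ {q} → toℕ r ≡ suc (toℕ q) → ClosedNbhdView i r (i , q)

  view : ∀ {i r u} → (i , r) ∈N[ u ] → ClosedNbhdView i r u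
  view (inj₁ refl) = here
  view (inj₂ (inj₁ (a , refl))) with cycle-adj⇒ a
  ... | inj₁ e    = left (sym e)
  ... | inj₂ refl = right
  view (inj₂ (inj₂ (refl , inj₁ e))) = below e
  view (inj₂ (inj₂ (refl , inj₂ e))) = above e

  Dominator : Fin m → Fin n → Set
  Dominator i r = ∃ λ u → D u ≡ true × ClosedNbhdView i r u

  dominator : ∀ i r → Dominator i r
  dominator i r with eds (i , r)
  ... | u , (Du , v∈N[u]) , _ = u , Du , view v∈N[u]

  same-dominator : ∀ {v u w} → D u ≡ true → D w ≡ true → v ∈N[ u ] → v ∈N[ w ] → u ≡ w
  same-dominator {v} Du Dw v∈N[u] v∈N[w] with eds v
  ... | _ , _ , unique = trans (unique _ Du v∈N[u]) (sym (unique _ Dw v∈N[w]))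

  ≢-next : ∀ {i r q} → _≢_ {A = Vertex} (i , r) (next i , q)
  ≢-next e = next≢id (<⇒≤ 3≤m) _ (sym (,-injectiveˡ e))

  ≢-next² : ∀ {i r q} → _≢_ {A = Vertex} (i , r) (next (next i) , q)
  ≢-next² e = next²≢id 3≤m _ (sym (,-injectiveˡ e))

  no-adjacent-dominators : ∀ {i r} → D (i , r) ≡ true → D (next i , r) ≡ true → ⊥
  no-adjacent-dominators Di Dnext-i = ≢-next (same-dominator Di Dnext-i ∈N-self ∈N-prev)

  some-column : Fin m
  some-column = fromℕ< 3≤m

module OneRow {m : ℕ} .{{_ : NonZero m}} (3≤m : 3 ≤ m) {D : Fin m × Fin 1 → Bool}
              (eds : IsEfficientDominatingSet (Cycle m □ Path 1) D) where
  open Domination 3≤m eds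

  period3 : ∀ {i} → D (i , zero) ≡ true → D (next^ 3 i , zero) ≡ true
  period3 {i} d₀ with dominator (next^ 2 i) zero
  ... | _ , d , here  = contradiction (same-dominator d₀ d ∈N-next ∈N-prev) ≢-next²
  ... | _ , d , right = d
  ... | _ , d , above {zero} ()
  ... | _ , d , below ()
  ... | _ , d , left e with next-injective e
  ...   | refl = ⊥-elim (no-adjacent-dominators d₀ d)

  gap3 : ∀ {i} t → t < 3 → D (i , zero) ≡ true → D (next^ t i , zero) ≡ true → t ≡ 0
  gap3 0 _ _  _ = refl
  gap3 1 _ d₀ d = ⊥-elim (no-adjacent-dominators d₀ d)
  gap3 2 _ d₀ d = contradiction (same-dominator d₀ d ∈N-next ∈N-prev) ≢-next²
  gap3 (suc (suc (suc _))) (s≤s (s≤s (s≤s ()))) _ _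

  bottom-row-dominator : ∃ λ i → D (i , zero) ≡ true
  bottom-row-dominator with dominator some-column zero
  ... | _ , d , here   = _ , d
  ... | _ , d , right  = _ , d
  ... | _ , d , left _ = _ , d
  ... | _ , d , above {zero} ()
  ... | _ , d , below ()

  m%3≡0 : m % 3 ≡ 0
  m%3≡0 = periodic⇒m%P≡0 (λ i → D (i , zero) ≡ true) 3 period3 gap3 bottom-row-dominator

module TwoRows {m n : ℕ} .{{_ : NonZero m}} (3≤m : 3 ≤ m) {D : Fin m × Fin (2 + n) → Bool}
               (eds : IsEfficientDominatingSet (Cycle m □ Path (2 + n)) D) where
  open Domination 3≤m eds

  top⇒bottom : ∀ {i} → D (i , suc zero) ≡ true → D (next^ 2 i , zero) ≡ true
  top⇒bottom {i} d₁ with dominator (next i) zero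
  ... | _ , d , here                  = contradiction (same-dominator d₁ d ∈N-next (∈N-up refl)) λ ()
  ... | _ , d , right                 = d
  ... | _ , d , above {suc zero} refl = contradiction (same-dominator d₁ d ∈N-next ∈N-self) ≢-next
  ... | _ , d , above {zero} ()
  ... | _ , d , above {suc (suc _)} ()
  ... | _ , d , below ()
  ... | _ , d , left e with next-injective e
  ...   | refl = contradiction (same-dominator d₁ d (∈N-down refl) ∈N-self) λ ()

  ¬bottom-beside-row₂ : ∀ {i q} → toℕ q ≡ 2 → D (i , zero) ≡ true → D (next i , q) ≡ true → ⊥
  ¬bottom-beside-row₂ {q = zero} ()
  ¬bottom-beside-row₂ {q = suc zero} ()
  ¬bottom-beside-row₂ {i} {q@(suc (suc _))} q≡2 d₀ d₂ = bottom-undominated (dominator (next^ 2 i) zero)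
    where
    top-undominated : D (next^ 3 i , zero) ≡ true → Dominator (next^ 2 i) (suc zero) → ⊥
    top-undominated d₃ (_ , d , here)  = contradiction (same-dominator d₃ d ∈N-prev (∈N-down refl)) λ ()
    top-undominated d₃ (_ , d , right) = contradiction (same-dominator d₃ d ∈N-self (∈N-down refl)) λ ()
    top-undominated d₃ (_ , d , below {zero} refl) =
      contradiction (same-dominator d₃ d ∈N-prev ∈N-self) (≢-next ∘ sym)
    top-undominated d₃ (_ , d , below {suc _} ())
    top-undominated d₃ (_ , d , above e) with toℕ-injective {j = q} (trans e (sym q≡2))
    ... | refl = contradiction (same-dominator d₂ d ∈N-next ∈N-self) ≢-next
    top-undominated d₃ (_ , d , left e) with next-injective e
    ... | refl = contradiction (same-dominator d₂ d (∈N-down q≡2) ∈N-self) λ ()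

    bottom-undominated : Dominator (next^ 2 i) zero → ⊥
    bottom-undominated (_ , d , here)  = contradiction (same-dominator d₀ d ∈N-next ∈N-prev) ≢-next²
    bottom-undominated (_ , d , right) = top-undominated d (dominator (next^ 2 i) (suc zero))
    bottom-undominated (_ , d , above {suc zero} refl) =
      contradiction (same-dominator d₂ d (∈N-down q≡2) ∈N-prev) λ ()
    bottom-undominated (_ , d , above {zero} ())
    bottom-undominated (_ , d , above {suc (suc _)} ())
    bottom-undominated (_ , d , below ())
    bottom-undominated (_ , d , left e) with next-injective e
    ... | refl = no-adjacent-dominators d₀ d

  bottom⇒top : ∀ {i} → D (i , zero) ≡ true → D (next^ 2 i , suc zero) ≡ true
  bottom⇒top {i} d₀ with dominator (next i) (suc zero)
  ... | _ , d , here              = contradiction (same-dominator d₀ d ∈N-next (∈N-down refl)) λ ()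
  ... | _ , d , right             = d
  ... | _ , d , above e           = ⊥-elim (¬bottom-beside-row₂ e d₀ d)
  ... | _ , d , below {zero} refl = ⊥-elim (no-adjacent-dominators d₀ d)
  ... | _ , d , below {suc _} ()
  ... | _ , d , left e with next-injective e
  ...   | refl = contradiction (same-dominator d₀ d (∈N-up refl) ∈N-self) λ ()

  period4 : ∀ {i} → D (i , zero) ≡ true → D (next^ 4 i , zero) ≡ true
  period4 = top⇒bottom ∘ bottom⇒top

  gap4 : ∀ {i} t → t < 4 → D (i , zero) ≡ true → D (next^ t i , zero) ≡ true → t ≡ 0
  gap4 0 _ _  _ = refl
  gap4 1 _ d₀ d = ⊥-elim (no-adjacent-dominators d₀ d)
  gap4 2 _ d₀ d = contradiction (same-dominator d (bottom⇒top d₀) ∈N-self (∈N-down refl)) λ ()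
  gap4 3 _ d₀ d = ⊥-elim (no-adjacent-dominators d (period4 d₀))
  gap4 (suc (suc (suc (suc _)))) (s≤s (s≤s (s≤s (s≤s ())))) _ _

  bottom-row-dominator : ∃ λ i → D (i , zero) ≡ true
  bottom-row-dominator with dominator some-column zero
  ... | _ , d , here                  = _ , d
  ... | _ , d , right                 = _ , d
  ... | _ , d , left _                = _ , d
  ... | _ , d , above {suc zero} refl = _ , top⇒bottom d
  ... | _ , d , above {zero} ()
  ... | _ , d , above {suc (suc _)} ()
  ... | _ , d , below ()

  m%4≡0 : m % 4 ≡ 0
  m%4≡0 = periodic⇒m%P≡0 (λ i → D (i , zero) ≡ true) 4 period4 gap4 bottom-row-dominator

module ThreeRows {m n : ℕ} .{{_ : NonZero m}} (3≤m : 3 ≤ m) {D : Fin m × Fin (3 + n) → Bool}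
                 (eds : IsEfficientDominatingSet (Cycle m □ Path (3 + n)) D) where
  open Domination 3≤m eds
  open TwoRows 3≤m eds

  ¬top-dominator : ∀ {i} → D (i , suc zero) ≡ true → ⊥
  ¬top-dominator {i} d₁ = row₂-undominated (dominator (next^ 2 i) row₂)
    where
    row₂ : Fin (3 + n)
    row₂ = suc (suc zero)

    d₀ : D (next^ 2 i , zero) ≡ true
    d₀ = top⇒bottom d₁

    d₁′ : D (next^ 4 i , suc zero) ≡ true
    d₁′ = bottom⇒top d₀

    beside-undominated : ∀ {q} → toℕ q ≡ 3 → D (next^ 2 i , q) ≡ true → Dominator (next^ 3 i) row₂ → ⊥
    beside-undominated _   _  (_ , d , here) =
      contradiction (same-dominator d₁′ d ∈N-prev (∈N-down refl)) λ ()
    beside-undominated _   _  (_ , d , right) =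
      contradiction (same-dominator d₁′ d ∈N-self (∈N-down refl)) λ ()
    beside-undominated _   _  (_ , d , below {suc zero} refl) =
      contradiction (same-dominator d₁′ d ∈N-prev ∈N-self) (≢-next ∘ sym)
    beside-undominated _   _  (_ , d , below {zero} ())
    beside-undominated _   _  (_ , d , below {suc (suc _)} ())
    beside-undominated q≡3 d₃ (_ , d , above e) with toℕ-injective (trans e (sym q≡3))
    ... | refl = contradiction (same-dominator d₃ d ∈N-next ∈N-self) ≢-next
    beside-undominated _   _  (_ , d , left e) with next-injective e
    ... | refl = contradiction (same-dominator d₀ d (∈N-up refl) (∈N-down refl)) λ ()

    row₂-undominated : Dominator (next^ 2 i) row₂ → ⊥
    row₂-undominated (_ , d , here)  = contradiction (same-dominator d₀ d (∈N-up refl) (∈N-down refl)) λ ()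
    row₂-undominated (_ , d , right) = contradiction (same-dominator d₁′ d ∈N-prev (∈N-down refl)) λ ()
    row₂-undominated (_ , d , above q≡3) = beside-undominated q≡3 d (dominator (next^ 3 i) row₂)
    row₂-undominated (_ , d , below {suc zero} refl) =
      contradiction (same-dominator d₀ d ∈N-self (∈N-down refl)) λ ()
    row₂-undominated (_ , d , below {zero} ())
    row₂-undominated (_ , d , below {suc (suc _)} ())
    row₂-undominated (_ , d , left e) with next-injective e
    ... | refl = contradiction (same-dominator d₁ d ∈N-next (∈N-down refl)) λ ()

  ⊥-from-efficiency : ⊥
  ⊥-from-efficiency = ¬top-dominator (bottom⇒top (proj₂ bottom-row-dominator))

mainTheorem3 : (m n : ℕ) → 3 ≤ m → 1 ≤ n →
    HasEfficientDominatingSet (Cycle m □ Path n)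
      ⇔ ((n ≡ 1 × m % 3 ≡ 0) ⊎ (n ≡ 2 × m % 4 ≡ 0))
mainTheorem3 m@(suc _) n 3≤m 1≤n = mk⇔ (necessary 1≤n) sufficient
  where
  necessary : ∀ {n} → 1 ≤ n → HasEfficientDominatingSet (Cycle m □ Path n) →
              (n ≡ 1 × m % 3 ≡ 0) ⊎ (n ≡ 2 × m % 4 ≡ 0)
  necessary {0}                   ()
  necessary {1}                   _ (_ , eds) = inj₁ (refl , OneRow.m%3≡0 3≤m eds)
  necessary {2}                   _ (_ , eds) = inj₂ (refl , TwoRows.m%4≡0 3≤m eds)
  necessary {suc (suc (suc _))}   _ (_ , eds) = ⊥-elim (ThreeRows.⊥-from-efficiency 3≤m eds)

  sufficient : (n ≡ 1 × m % 3 ≡ 0) ⊎ (n ≡ 2 × m % 4 ≡ 0) → HasEfficientDominatingSet (Cycle m □ Path n)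
  sufficient (inj₁ (refl , m%3≡0)) = efficient-from-divisor (m%n≡0⇒n∣m m 3 m%3≡0) ≤-refl seed-C₃□P₁
  sufficient (inj₂ (refl , m%4≡0)) =
    efficient-from-divisor (m%n≡0⇒n∣m m 4 m%4≡0) (s≤s (s≤s (s≤s z≤n))) seed-C₄□P₂
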